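{- Let $G=(V,E)$ be a graph, $c\ge1$, $\epsilon\in[0,1/3)$, let $\kappa(G)$ be an $(\epsilon,c)$-kernel of $G$ with tight nodes $\kappa_T(V)$, and let $M$ be a matching in $\kappa(G)$ such that every augmenting path in $\kappa(G)$ with respect to $M$ has length at least five. Let $F_T$ be the set of tight nodes unmatched in $M$. Then $|F_T|\le(1+3\epsilon)|M|$.
   Context: For $v\in V$ let $\mathcal{N}_v$ be its neighbors in $G$. A subgraph $\kappa(G)=(V,\kappa(E))$ with $\kappa(E)\subseteq E$, together with a partition of $V$ into tight nodes $\kappa_T(V)$ and slack nodes $\kappa_S(V)$, is an $(\epsilon,c)$-kernel of $G$ if, with $\kappa(\mathcal{N}_v)=\{u\in\mathcal{N}_v:(u,v)\in\kappa(E)\}$: (i) $|\kappa(\mathcal{N}_v)|\le(1+\epsilon)c$ for all $v\in V$; (ii) $|\kappa(\mathcal{N}_v)|\ge(1-\epsilon)c$ for all $v\in\kappa_T(V)$; (iii) every edge of $G$ joining two slack nodes lies in $\kappa(E)$. An augmenting path with respect to $M$ is a simple path whose endpoints are unmatched in $M$ and whose edges alternate between non-$M$ and $M$ edges; its length is its number of edges.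
   Formalization: The parameters ε and c are taken in the rationals. -}

module Defs where

open import Data.Bool using (Bool; true; false; not; _∧_; if_then_else_)
open import Data.Nat using (ℕ; _<ᵇ_)
open import Data.Nat.ListAction using (sum)
open import Data.Fin using (Fin; toℕ)
open import Data.List using (List; []; _∷_; [_]; map; length; last)
open import Data.List.Relation.Unary.Unique.Propositional using (Unique)
open import Data.Maybe using (just)
open import Data.Integer using (+_)
open import Data.Rational using (ℚ; _/_; _+_; _-_; _*_; _≤_; _<_; 0ℚ; 1ℚ)
open import Data.Product using (_×_; Σ)
open import Data.Vec using (allFin)
open import Relation.Binary.PropositionalEquality using (_≡_)

count : ∀ {n} → (Fin n → Bool) → ℕ
count {n} p = sum (map (λ i → if p i then 1 else 0) (Data.Vec.toList (allFin n)))

ℕ→ℚ : ℕ → ℚ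
ℕ→ℚ k = + k / 1

record Graph (n : ℕ) : Set where
  field
    adj   : Fin n → Fin n → Bool
    sym   : ∀ u v → adj u v ≡ true → adj v u ≡ true
    irrefl : ∀ v → adj v v ≡ false

SymSub : ∀ {n} → (Fin n → Fin n → Bool) → (Fin n → Fin n → Bool) → Set
SymSub R S = (∀ u v → R u v ≡ true → R v u ≡ true) × (∀ u v → R u v ≡ true → S u v ≡ true)

deg : ∀ {n} → (Fin n → Fin n → Bool) → Fin n → ℕ
deg R v = count (R v)

edgeCount : ∀ {n} → (Fin n → Fin n → Bool) → ℕ
edgeCount R = sum (map (λ u → count (λ v → R u v ∧ (toℕ u <ᵇ toℕ v)))
                       (Data.Vec.toList (allFin _)))

-- (ε,c)-kernel: kernel edge set K ⊆ E, tightness predicate T (slack = not tight)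
record IsKernel {n} (G : Graph n) (ε c : ℚ) (K : Fin n → Fin n → Bool)
                (T : Fin n → Bool) : Set where
  field
    sub     : SymSub K (Graph.adj G)
    degUpper : ∀ v → ℕ→ℚ (deg K v) ≤ (1ℚ + ε) * c
    degLower : ∀ v → T v ≡ true → (1ℚ - ε) * c ≤ ℕ→ℚ (deg K v)
    slackEdges : ∀ u v → T u ≡ false → T v ≡ false → Graph.adj G u v ≡ true → K u v ≡ true

record IsMatching {n} (K M : Fin n → Fin n → Bool) : Set where
  field
    sub    : SymSub M K
    unique : ∀ v u w → M v u ≡ true → M v w ≡ true → u ≡ w

Unmatched : ∀ {n} → (Fin n → Fin n → Bool) → Fin n → Set
Unmatched M v = ∀ u → M v u ≡ false

data Alt {n} (K M : Fin n → Fin n → Bool) : Bool → List (Fin n) → Set where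
  end  : ∀ {b} v → Alt K M b [ v ]
  step : ∀ {b} u v vs → K u v ≡ true → M u v ≡ b → Alt K M (not b) (v ∷ vs)
       → Alt K M b (u ∷ v ∷ vs)

-- augmenting path in (V,K) w.r.t. M, given as its vertex list (length = #vertices - 1 ≥ 1)
record IsAugPath {n} (K M : Fin n → Fin n → Bool) (vs : List (Fin n)) : Set where
  field
    start  : Fin n
    finish : Fin n
    rest   : List (Fin n)
    shape  : vs ≡ start ∷ rest
    nonTriv : 1 Data.Nat.≤ length rest
    lastIs : last vs ≡ just finish
    simple : Unique vs
    alt    : Alt K M false vs
    startFree  : Unmatched M start
    finishFree : Unmatched M finish

pathLength : ∀ {A : Set} → List A → ℕ
pathLength vs = length vs Data.Nat.∸ 1

isUnmatched : ∀ {n} → (Fin n → Fin n → Bool) → Fin n → Bool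
isUnmatched M v = count (M v) Data.Nat.≡ᵇ 0

module Submission where

-- Let F be the set of free tight vertices and degF x the number of kernel neighbours of x in F.
-- Every vertex of F has kernel degree at least (1 - ε) c, so |F| (1 - ε) c ≤ Σₓ degF x.  A kernel
-- neighbour of a free vertex is matched (there is no augmenting path of length 1), so the sum
-- Σₓ degF x splits into degF x + degF y over the matched edges {x, y}.  If x has a free neighbour u,
-- then u is the only free neighbour of y (there is no augmenting path u x y w of length 3) and y is
-- a neighbour of x outside F; hence degF x + degF y ≤ max (deg x) (deg y) ≤ (1 + ε) c.  This gives
-- (1 - ε) |F| ≤ (1 + ε) |M|, and (1 + ε) / (1 - ε) ≤ 1 + 3ε because ε (1 - 3ε) ≥ 0.

open import Defs
open import Data.Bool using (Bool; true; false; _∧_)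
open import Data.Fin using (Fin)
open import Data.List using (List)
open import Data.Nat using (ℕ)
open import Relation.Binary.PropositionalEquality using (_≡_)

module Counting where
  open import Data.Bool using (if_then_else_; T)
  open import Data.Unit using (tt)
  open import Data.Empty using (⊥-elim)
  open import Data.Fin using (zero; suc; toℕ; punchIn)
  open import Data.Fin.Properties using (punchInᵢ≢i; toℕ-injective; any?)
  import Data.Nat.ListAction as List
  open import Data.List using (map; filter; allFin)
  import Data.List.Relation.Unary.All as All
  open import Data.List.Relation.Unary.All.Properties using (all-filter)
  open import Data.List.Membership.Propositional.Properties using (∈-allFin; ∈-filter⁺)
  open import Data.List.Extrema.Nat using (argmin; argmax; argmin-all; f[argmin]≤f[xs]; f[xs]≤f[argmax])
  open import Data.Nat using (zero; suc; _+_; _*_; _≤_; _<_; _<ᵇ_; z≤n)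
  open import Data.Nat.Properties
  open import Data.Product using (∃; _×_; _,_)
  open import Data.Sum using (_⊎_; inj₁; inj₂)
  import Data.Vec as Vec
  open import Function using (_∘_; id)
  open import Relation.Binary.PropositionalEquality
  open import Relation.Nullary using (Dec; yes; no)
  import Data.Bool.Properties as Bool

  open import Algebra.Properties.Semiring.Sum +-*-semiring public

  ∧-elim : ∀ {a b} → a ∧ b ≡ true → a ≡ true × b ≡ true
  ∧-elim {true} {true} refl = refl , refl

  ⟦_⟧ : Bool → ℕ
  ⟦ b ⟧ = if b then 1 else 0

  ∑-mono-≤ : ∀ {n} {f g : Fin n → ℕ} → (∀ i → f i ≤ g i) → sum f ≤ sum g
  ∑-mono-≤ {zero} le = z≤n
  ∑-mono-≤ {suc n} le = +-mono-≤ (le zero) (∑-mono-≤ (le ∘ suc))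

  ∑-mono-< : ∀ {n} {f g : Fin n → ℕ} → (∀ i → f i ≤ g i) → ∀ {j} → f j < g j → sum f < sum g
  ∑-mono-< le {zero} lt = +-mono-<-≤ lt (∑-mono-≤ (le ∘ suc))
  ∑-mono-< le {suc j} lt = +-mono-≤-< (le zero) (∑-mono-< (le ∘ suc) lt)

  term≤∑ : ∀ {n} (f : Fin n → ℕ) i → f i ≤ sum f
  term≤∑ {suc n} f i = subst (f i ≤_) (sym (sum-remove {i = i} f)) (m≤m+n (f i) _)

  ∑-single : ∀ {n} (f : Fin n → ℕ) k → (∀ i → i ≢ k → f i ≡ 0) → sum f ≡ f k
  ∑-single {suc n} f k zero-off = begin
    sum f                               ≡⟨ sum-remove {i = k} f ⟩
    f k + sum (f ∘ punchIn k)           ≡⟨ cong (f k +_) (sum-cong-≗ {n} (λ j → zero-off _ (punchInᵢ≢i k j))) ⟩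
    f k + sum {n} (λ _ → 0)             ≡⟨ cong (f k +_) (sum-replicate-zero n) ⟩
    f k + 0                             ≡⟨ +-identityʳ (f k) ⟩
    f k                                 ∎
    where open ≡-Reasoning

  sum-map-tabulate : ∀ {n} {A : Set} (g : A → ℕ) (h : Fin n → A) →
                     List.sum (map g (Vec.toList (Vec.tabulate h))) ≡ ∑[ i < n ] g (h i)
  sum-map-tabulate {zero} g h = refl
  sum-map-tabulate {suc n} g h = cong (g (h zero) +_) (sum-map-tabulate g (h ∘ suc))

  count≡∑ : ∀ {n} (p : Fin n → Bool) → count p ≡ ∑[ i < n ] ⟦ p i ⟧
  count≡∑ p = sum-map-tabulate (λ i → ⟦ p i ⟧) id

  ⟦⟧-mono : ∀ {a b} → (a ≡ true → b ≡ true) → ⟦ a ⟧ ≤ ⟦ b ⟧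
  ⟦⟧-mono {false} _ = z≤n
  ⟦⟧-mono {true} a⇒b rewrite a⇒b refl = ≤-refl

  ⟦⟧≤1 : ∀ b → ⟦ b ⟧ ≤ 1
  ⟦⟧≤1 false = z≤n
  ⟦⟧≤1 true = ≤-refl

  count-mono-≤ : ∀ {n} (p q : Fin n → Bool) → (∀ i → p i ≡ true → q i ≡ true) → count p ≤ count q
  count-mono-≤ p q p⇒q rewrite count≡∑ p | count≡∑ q = ∑-mono-≤ (⟦⟧-mono ∘ p⇒q)

  count-mono-< : ∀ {n} (p q : Fin n → Bool) → (∀ i → p i ≡ true → q i ≡ true) →
                 ∀ {j} → p j ≡ false → q j ≡ true → count p < count q
  count-mono-< p q p⇒q pj qj rewrite count≡∑ p | count≡∑ q =
    ∑-mono-< (⟦⟧-mono ∘ p⇒q) (subst₂ (λ a b → ⟦ a ⟧ < ⟦ b ⟧) (sym pj) (sym qj) ≤-refl)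

  count-pos : ∀ {n} {p : Fin n → Bool} {i} → p i ≡ true → 0 < count p
  count-pos {p = p} {i} pi = subst₂ _≤_ (cong ⟦_⟧ pi) (sym (count≡∑ p)) (term≤∑ (λ j → ⟦ p j ⟧) i)

  count≡0⇒false : ∀ {n} {p : Fin n → Bool} → count p ≡ 0 → ∀ i → p i ≡ false
  count≡0⇒false {p = p} count≡0 i = Bool.¬-not (λ pi → <⇒≢ (count-pos {p = p} pi) (sym count≡0))

  isUnmatched⇒Unmatched : ∀ {n} (M : Fin n → Fin n → Bool) {v} → isUnmatched M v ≡ true → Unmatched M v
  isUnmatched⇒Unmatched M {v} h = count≡0⇒false (≡ᵇ⇒≡ (count (M v)) 0 (subst T (sym h) tt))

  count-witness : ∀ {n} (p : Fin n → Bool) → count p ≡ 0 ⊎ ∃ λ i → p i ≡ true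
  count-witness {n} p with any? (λ i → p i Bool.≟ true)
  ... | yes witness = inj₂ witness
  ... | no none = inj₁ (begin
    count p               ≡⟨ count≡∑ p ⟩
    sum (λ i → ⟦ p i ⟧)   ≡⟨ sum-cong-≗ {n} (λ i → cong ⟦_⟧ (Bool.¬-not (λ pi → none (i , pi)))) ⟩
    sum {n} (λ _ → 0)     ≡⟨ sum-replicate-zero n ⟩
    0                     ∎)
    where open ≡-Reasoning

  count-≤1 : ∀ {n} {p : Fin n → Bool} k → (∀ i → p i ≡ true → i ≡ k) → count p ≤ 1
  count-≤1 {p = p} k only-k = begin
    count p               ≡⟨ count≡∑ p ⟩
    sum (λ i → ⟦ p i ⟧)   ≡⟨ ∑-single (λ i → ⟦ p i ⟧) k off-k ⟩
    ⟦ p k ⟧               ≤⟨ ⟦⟧≤1 (p k) ⟩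
    1                     ∎
    where
    open ≤-Reasoning
    off-k : ∀ i → i ≢ k → ⟦ p i ⟧ ≡ 0
    off-k i i≢k with p i in pi
    ... | false = refl
    ... | true = ⊥-elim (i≢k (only-k i pi))

  <ᵇ-total : ∀ m n → m ≢ n → ⟦ m <ᵇ n ⟧ + ⟦ n <ᵇ m ⟧ ≡ 1
  <ᵇ-total zero zero m≢n = ⊥-elim (m≢n refl)
  <ᵇ-total zero (suc n) _ = refl
  <ᵇ-total (suc m) zero _ = refl
  <ᵇ-total (suc m) (suc n) m≢n = <ᵇ-total m n (m≢n ∘ cong suc)

  _≺_ : ∀ {n} → Fin n → Fin n → Bool
  x ≺ y = toℕ x <ᵇ toℕ y

  ⟦⟧-split-≺ : ∀ {n} {R : Fin n → Fin n → Bool} → (∀ x y → R x y ≡ R y x) → (∀ x → R x x ≡ false) →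
               ∀ x y → ⟦ R x y ⟧ ≡ ⟦ R x y ∧ x ≺ y ⟧ + ⟦ R y x ∧ y ≺ x ⟧
  ⟦⟧-split-≺ {R = R} R-sym R-irrefl x y with R x y in Rxy | R y x in Ryx
  ... | false | false = refl
  ... | true | false with () ← trans (sym Rxy) (trans (R-sym x y) Ryx)
  ... | false | true with () ← trans (sym Ryx) (trans (R-sym y x) Rxy)
  ... | true | true = sym (<ᵇ-total (toℕ x) (toℕ y) (x≢y ∘ toℕ-injective))
    where
    x≢y : x ≢ y
    x≢y refl with () ← trans (sym Rxy) (R-irrefl x)

  ∑∑-symmetric : ∀ {n} {R : Fin n → Fin n → Bool} → (∀ x y → R x y ≡ R y x) → (∀ x → R x x ≡ false) →
                 (w : Fin n → ℕ) →
                 ∑[ x < n ] ∑[ y < n ] (⟦ R x y ⟧ * w x) ≡ ∑[ x < n ] ∑[ y < n ] (⟦ R x y ∧ x ≺ y ⟧ * (w x + w y))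
  ∑∑-symmetric {n} {R} R-sym R-irrefl w = begin
    ∑[ x < n ] ∑[ y < n ] (⟦ R x y ⟧ * w x)
      ≡⟨ ∑∑-cong split ⟩
    ∑[ x < n ] ∑[ y < n ] (e x y * w x + e y x * w x)
      ≡⟨ ∑∑-distrib-+ (λ x y → e x y * w x) (λ x y → e y x * w x) ⟩
    ∑∑ (λ x y → e x y * w x) + ∑∑ (λ x y → e y x * w x)
      ≡⟨ cong (∑∑ (λ x y → e x y * w x) +_) (∑-comm (λ x y → e y x * w x)) ⟩
    ∑∑ (λ x y → e x y * w x) + ∑∑ (λ x y → e x y * w y)
      ≡⟨ ∑∑-distrib-+ (λ x y → e x y * w x) (λ x y → e x y * w y) ⟨
    ∑[ x < n ] ∑[ y < n ] (e x y * w x + e x y * w y)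
      ≡⟨ ∑∑-cong (λ x y → *-distribˡ-+ (e x y) (w x) (w y)) ⟨
    ∑[ x < n ] ∑[ y < n ] (e x y * (w x + w y))
      ∎
    where
    open ≡-Reasoning
    e : Fin n → Fin n → ℕ
    e x y = ⟦ R x y ∧ x ≺ y ⟧
    ∑∑ : (Fin n → Fin n → ℕ) → ℕ
    ∑∑ f = ∑[ x < n ] ∑[ y < n ] f x y
    ∑∑-cong : ∀ {f g : Fin n → Fin n → ℕ} → (∀ x y → f x y ≡ g x y) → ∑∑ f ≡ ∑∑ g
    ∑∑-cong f≡g = sum-cong-≗ {n} (λ x → sum-cong-≗ {n} (f≡g x))
    ∑∑-distrib-+ : ∀ (f g : Fin n → Fin n → ℕ) → ∑∑ (λ x y → f x y + g x y) ≡ ∑∑ f + ∑∑ g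
    ∑∑-distrib-+ f g = trans (sum-cong-≗ {n} (λ x → ∑-distrib-+ (f x) (g x))) (∑-distrib-+ {n} _ _)
    split : ∀ x y → ⟦ R x y ⟧ * w x ≡ e x y * w x + e y x * w x
    split x y = trans (cong (_* w x) (⟦⟧-split-≺ R-sym R-irrefl x y)) (*-distribʳ-+ (w x) (e x y) (e y x))

  edgeCount≡∑ : ∀ {n} (R : Fin n → Fin n → Bool) → edgeCount R ≡ ∑[ x < n ] ∑[ y < n ] ⟦ R x y ∧ x ≺ y ⟧
  edgeCount≡∑ {n} R = trans (sum-map-tabulate (λ x → count (λ y → R x y ∧ x ≺ y)) id)
                            (sum-cong-≗ {n} (λ x → count≡∑ (λ y → R x y ∧ x ≺ y)))

  ⟦⟧*-monoʳ-≤ : ∀ {b m k} → (b ≡ true → m ≤ k) → ⟦ b ⟧ * m ≤ ⟦ b ⟧ * k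
  ⟦⟧*-monoʳ-≤ {false} _ = z≤n
  ⟦⟧*-monoʳ-≤ {true} m≤k = *-monoʳ-≤ 1 (m≤k refl)

  sym⇒≡ : ∀ {n} {R : Fin n → Fin n → Bool} → (∀ x y → R x y ≡ true → R y x ≡ true) → ∀ x y → R x y ≡ R y x
  sym⇒≡ {R = R} R-sym x y with R x y in Rxy | R y x in Ryx
  ... | false | false = refl
  ... | true | true = refl
  ... | true | false with () ← trans (sym (R-sym x y Rxy)) Ryx
  ... | false | true with () ← trans (sym (R-sym y x Ryx)) Rxy

  min-attained : ∀ {n} (f : Fin n → ℕ) (P : Fin n → Bool) {u₀} → P u₀ ≡ true →
                 ∃ λ z → P z ≡ true × (∀ u → P u ≡ true → f z ≤ f u)
  min-attained {n} f P {u₀} Pu₀ =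
    z , argmin-all f Pu₀ (all-filter P? (allFin n)) ,
    λ u Pu → All.lookup (f[argmin]≤f[xs] u₀ candidates) (∈-filter⁺ P? (∈-allFin u) Pu)
    where
    P? : ∀ u → Dec (P u ≡ true)
    P? u = P u Bool.≟ true
    candidates : List (Fin n)
    candidates = filter P? (allFin n)
    z : Fin n
    z = argmin f u₀ candidates

  max-attained : ∀ {n} (f : Fin n → ℕ) → Fin n → ∃ λ w → ∀ v → f v ≤ f w
  max-attained {n} f u₀ =
    argmax f u₀ (allFin n) , λ v → All.lookup (f[xs]≤f[argmax] u₀ (allFin n)) (∈-allFin v)

module AugmentingPaths {n} {K M : Fin n → Fin n → Bool}
    (K-irrefl : ∀ v → K v v ≡ false) (M⊆K : SymSub M K) where
  open import Data.Fin using (_≟_)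
  open import Data.List using ([]; _∷_)
  open import Data.List.Relation.Unary.AllPairs using ([]; _∷_)
  open import Data.List.Relation.Unary.All using ([]; _∷_)
  open import Data.Nat using (_≤_; s≤s; z≤n)
  open import Data.Product using (proj₁; proj₂)
  open import Relation.Binary.PropositionalEquality
  open import Relation.Nullary using (yes; no; ¬_)
  import Data.Bool.Properties as Bool
  open import Function using (_∘_)

  adjacent⇒≢ : ∀ {u v} → K u v ≡ true → u ≢ v
  adjacent⇒≢ {u} Kuv refl with () ← trans (sym Kuv) (K-irrefl u)

  M-irrefl : ∀ x → M x x ≡ false
  M-irrefl x = Bool.¬-not (λ Mxx → adjacent⇒≢ (proj₂ M⊆K x x Mxx) refl)

  unmatched⇒≢matched : ∀ {u v w} → Unmatched M u → M v w ≡ true → u ≢ v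
  unmatched⇒≢matched {w = w} u-free Mvw refl with () ← trans (sym Mvw) (u-free w)

  unmatched-sym : ∀ {u} → Unmatched M u → ∀ v → M v u ≡ false
  unmatched-sym u-free v = Bool.¬-not (λ Mvu → unmatched⇒≢matched u-free (proj₁ M⊆K v _ Mvu) refl)

  unmatched-nonadjacent : (∀ vs → IsAugPath K M vs → 2 ≤ pathLength vs) →
                          ∀ {u v} → Unmatched M u → Unmatched M v → ¬ K u v ≡ true
  unmatched-nonadjacent long {u} {v} u-free v-free Kuv with long (u ∷ v ∷ []) record
    { start = u ; finish = v ; rest = v ∷ [] ; shape = refl ; nonTriv = s≤s z≤n ; lastIs = refl
    ; simple = (adjacent⇒≢ Kuv ∷ []) ∷ [] ∷ []
    ; alt = step u v [] Kuv (u-free v) (end v)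
    ; startFree = u-free ; finishFree = v-free }
  ... | s≤s ()

  unmatched-neighbours-of-matched-edge-coincide :
    (∀ vs → IsAugPath K M vs → 4 ≤ pathLength vs) →
    ∀ {x y u w} → M x y ≡ true → Unmatched M u → K u x ≡ true → Unmatched M w → K y w ≡ true → u ≡ w
  unmatched-neighbours-of-matched-edge-coincide long {x} {y} {u} {w} Mxy u-free Kux w-free Kyw with u ≟ w
  ... | yes u≡w = u≡w
  ... | no u≢w with long (u ∷ x ∷ y ∷ w ∷ []) record
    { start = u ; finish = w ; rest = x ∷ y ∷ w ∷ [] ; shape = refl ; nonTriv = s≤s z≤n ; lastIs = refl
    ; simple = (adjacent⇒≢ Kux ∷ unmatched⇒≢matched u-free (proj₁ M⊆K x y Mxy) ∷ u≢w ∷ [])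
             ∷ (adjacent⇒≢ Kxy ∷ (unmatched⇒≢matched w-free Mxy ∘ sym) ∷ [])
             ∷ (adjacent⇒≢ Kyw ∷ [])
             ∷ [] ∷ []
    ; alt = step u x _ Kux (u-free x) (step x y _ Kxy Mxy (step y w [] Kyw (unmatched-sym w-free y) (end w)))
    ; startFree = u-free ; finishFree = w-free }
    where
    Kxy : K x y ≡ true
    Kxy = proj₂ M⊆K x y Mxy
  ... | s≤s (s≤s (s≤s ()))

module FreeNeighbours {n} {K M : Fin n → Fin n → Bool}
    (K-sym : ∀ u v → K u v ≡ true → K v u ≡ true) (K-irrefl : ∀ v → K v v ≡ false) (M⊆K : SymSub M K)
    (F : Fin n → Bool) (F-free : ∀ u → F u ≡ true → Unmatched M u)
    (long : ∀ vs → IsAugPath K M vs → 4 Data.Nat.≤ pathLength vs) where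
  open import Data.Nat using (suc; _+_; _*_; _≤_; _⊔_; z≤n; s≤s)
  open import Data.Nat.Properties
  open import Data.Product using (∃; _,_; proj₁; proj₂)
  open import Data.Sum using (inj₁; inj₂)
  open import Function using (_∘_)
  open import Relation.Binary.PropositionalEquality
  import Data.Bool.Properties as Bool
  open Counting
  open AugmentingPaths K-irrefl M⊆K

  degF : Fin n → ℕ
  degF x = count (λ u → F u ∧ K x u)

  adjacent-to-free⇒matched : ∀ {x u} → F u ≡ true → K x u ≡ true → ∃ λ y → M x y ≡ true
  adjacent-to-free⇒matched {x} Fu Kxu with count-witness (M x)
  ... | inj₂ partner = partner
  ... | inj₁ x-free with () ← unmatched-nonadjacent (λ vs p → ≤-trans (s≤s (s≤s z≤n)) (long vs p))
                               (F-free _ Fu) (count≡0⇒false x-free) (K-sym x _ Kxu)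

  degF≤matched : ∀ x → degF x ≤ ∑[ y < n ] (⟦ M x y ⟧ * degF x)
  degF≤matched x with count-witness (λ u → F u ∧ K x u)
  ... | inj₁ degF≡0 = ≤-trans (≤-reflexive degF≡0) z≤n
  ... | inj₂ (u , FKxu) with adjacent-to-free⇒matched (proj₁ (∧-elim FKxu)) (proj₂ (∧-elim FKxu))
  ...   | y , Mxy = begin
    degF x                            ≡⟨ sym (+-identityʳ (degF x)) ⟩
    ⟦ true ⟧ * degF x                 ≡⟨ cong (λ b → ⟦ b ⟧ * degF x) (sym Mxy) ⟩
    ⟦ M x y ⟧ * degF x                ≤⟨ term≤∑ (λ z → ⟦ M x z ⟧ * degF x) y ⟩
    ∑[ z < n ] (⟦ M x z ⟧ * degF x)   ∎
    where open ≤-Reasoning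

  degF-matched-edge : ∀ {x y} → M x y ≡ true → degF x + degF y ≤ deg K x ⊔ deg K y
  degF-matched-edge {x} {y} Mxy with count-witness (λ u → F u ∧ K x u)
  ... | inj₁ degF≡0 = begin
    degF x + degF y   ≡⟨ cong (_+ degF y) degF≡0 ⟩
    degF y            ≤⟨ count-mono-≤ _ (K y) (λ w → proj₂ ∘ ∧-elim) ⟩
    deg K y           ≤⟨ m≤n⊔m (deg K x) (deg K y) ⟩
    deg K x ⊔ deg K y ∎
    where open ≤-Reasoning
  ... | inj₂ (u , FKxu) = begin
    degF x + degF y   ≤⟨ +-monoʳ-≤ (degF x) degF-y≤1 ⟩
    degF x + 1        ≡⟨ +-comm (degF x) 1 ⟩
    suc (degF x)      ≤⟨ count-mono-< _ (K x) (λ w → proj₂ ∘ ∧-elim) y-not-free (proj₂ M⊆K x y Mxy) ⟩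
    deg K x           ≤⟨ m≤m⊔n (deg K x) (deg K y) ⟩
    deg K x ⊔ deg K y ∎
    where
    open ≤-Reasoning
    Fu : F u ≡ true
    Fu = proj₁ (∧-elim FKxu)
    Kxu : K x u ≡ true
    Kxu = proj₂ (∧-elim FKxu)
    degF-y≤1 : degF y ≤ 1
    degF-y≤1 = count-≤1 u (λ w FKyw → sym (unmatched-neighbours-of-matched-edge-coincide long Mxy
                 (F-free u Fu) (K-sym x u Kxu) (F-free w (proj₁ (∧-elim FKyw))) (proj₂ (∧-elim FKyw))))
    y-not-free : (F y ∧ K x y) ≡ false
    y-not-free with F y in Fy
    ... | false = refl
    ... | true with () ← trans (sym (proj₁ M⊆K x y Mxy)) (F-free y Fy x)

  count*δ≤∑degF : ∀ δ → (∀ u → F u ≡ true → δ ≤ deg K u) → count F * δ ≤ ∑[ x < n ] degF x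
  count*δ≤∑degF δ δ≤deg = begin
    count F * δ                                   ≡⟨ cong (_* δ) (count≡∑ F) ⟩
    (∑[ u < n ] ⟦ F u ⟧) * δ                      ≡⟨ *-distribʳ-sum δ (λ u → ⟦ F u ⟧) ⟩
    ∑[ u < n ] (⟦ F u ⟧ * δ)                      ≤⟨ ∑-mono-≤ F-degree ⟩
    ∑[ u < n ] ∑[ x < n ] ⟦ F u ∧ K x u ⟧         ≡⟨ ∑-comm (λ u x → ⟦ F u ∧ K x u ⟧) ⟩
    ∑[ x < n ] ∑[ u < n ] ⟦ F u ∧ K x u ⟧         ≡⟨ sum-cong-≗ {n} (λ x → count≡∑ (λ u → F u ∧ K x u)) ⟨
    ∑[ x < n ] degF x                             ∎
    where
    open ≤-Reasoning
    F-degree : ∀ u → ⟦ F u ⟧ * δ ≤ ∑[ x < n ] ⟦ F u ∧ K x u ⟧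
    F-degree u with F u in Fu
    ... | false = z≤n
    ... | true = begin
      δ + 0                       ≡⟨ +-identityʳ δ ⟩
      δ                           ≤⟨ δ≤deg u Fu ⟩
      deg K u                     ≤⟨ count-mono-≤ (K u) (λ x → K x u) (K-sym u) ⟩
      count (λ x → K x u)         ≡⟨ count≡∑ (λ x → K x u) ⟩
      ∑[ x < n ] ⟦ K x u ⟧        ∎

  ∑degF≤edgeCount*Δ : ∀ Δ → (∀ v → deg K v ≤ Δ) → ∑[ x < n ] degF x ≤ edgeCount M * Δ
  ∑degF≤edgeCount*Δ Δ deg≤Δ = begin
    ∑[ x < n ] degF x
      ≤⟨ ∑-mono-≤ degF≤matched ⟩
    ∑[ x < n ] ∑[ y < n ] (⟦ M x y ⟧ * degF x)
      ≡⟨ ∑∑-symmetric (sym⇒≡ (proj₁ M⊆K)) M-irrefl degF ⟩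
    ∑[ x < n ] ∑[ y < n ] (e x y * (degF x + degF y))
      ≤⟨ ∑-mono-≤ (λ x → ∑-mono-≤ (λ y → ⟦⟧*-monoʳ-≤ (matched-edge x y))) ⟩
    ∑[ x < n ] ∑[ y < n ] (e x y * Δ)
      ≡⟨ sum-cong-≗ {n} (λ x → *-distribʳ-sum Δ (e x)) ⟨
    ∑[ x < n ] ((∑[ y < n ] e x y) * Δ)
      ≡⟨ *-distribʳ-sum Δ (λ x → ∑[ y < n ] e x y) ⟨
    (∑[ x < n ] ∑[ y < n ] e x y) * Δ
      ≡⟨ cong (_* Δ) (edgeCount≡∑ M) ⟨
    edgeCount M * Δ
      ∎
    where
    open ≤-Reasoning
    e : Fin n → Fin n → ℕ
    e x y = ⟦ M x y ∧ x ≺ y ⟧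
    matched-edge : ∀ x y → (M x y ∧ x ≺ y) ≡ true → degF x + degF y ≤ Δ
    matched-edge x y h = ≤-trans (degF-matched-edge (proj₁ (∧-elim h))) (⊔-lub (deg≤Δ x) (deg≤Δ y))

  count*δ≤edgeCount*Δ : ∀ δ Δ → (∀ u → F u ≡ true → δ ≤ deg K u) → (∀ v → deg K v ≤ Δ) →
                        count F * δ ≤ edgeCount M * Δ
  count*δ≤edgeCount*Δ δ Δ δ≤deg deg≤Δ = ≤-trans (count*δ≤∑degF δ δ≤deg) (∑degF≤edgeCount*Δ Δ deg≤Δ)

module RationalBounds where
  import Data.Nat as ℕ
  open import Data.Integer using (+_; +≤+; +<+)
  import Data.Integer.Properties as ℤ
  open import Data.Nat.Coprimality using (1-coprimeTo) renaming (sym to coprime-sym)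
  open import Data.Rational
  open import Data.Rational.Properties
  open import Data.Rational.Solver using (module +-*-Solver)
  open import Relation.Binary.PropositionalEquality

  ℕ→ℚ≡mkℚ : ∀ k → ℕ→ℚ k ≡ mkℚ (+ k) 0 (coprime-sym (1-coprimeTo k))
  ℕ→ℚ≡mkℚ k = normalize-coprime (coprime-sym (1-coprimeTo k))

  ℕ→ℚ-mono-≤ : ∀ {a b} → a ℕ.≤ b → ℕ→ℚ a ≤ ℕ→ℚ b
  ℕ→ℚ-mono-≤ {a} {b} a≤b rewrite ℕ→ℚ≡mkℚ a | ℕ→ℚ≡mkℚ b =
    *≤* (subst₂ Data.Integer._≤_ (sym (ℤ.*-identityʳ (+ a))) (sym (ℤ.*-identityʳ (+ b))) (+≤+ a≤b))

  ℕ→ℚ-nonNeg : ∀ a → 0ℚ ≤ ℕ→ℚ a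
  ℕ→ℚ-nonNeg a = ℕ→ℚ-mono-≤ {0} {a} ℕ.z≤n

  ℕ→ℚ-homo-* : ∀ a b → ℕ→ℚ (a ℕ.* b) ≡ ℕ→ℚ a * ℕ→ℚ b
  ℕ→ℚ-homo-* a b rewrite ℕ→ℚ≡mkℚ a | ℕ→ℚ≡mkℚ b = cong (_/ 1) (sym (ℤ.+◃n≡+n (a ℕ.* b)))

  p≤q⇒0≤q-p : ∀ {p q} → p ≤ q → 0ℚ ≤ q - p
  p≤q⇒0≤q-p {p} {q} p≤q = subst (_≤ q - p) (+-inverseʳ p) (+-monoˡ-≤ (- p) p≤q)

  p<q⇒0<q-p : ∀ {p q} → p < q → 0ℚ < q - p
  p<q⇒0<q-p {p} {q} p<q = subst (_< q - p) (+-inverseʳ p) (+-monoˡ-< (- p) p<q)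

  1+ε≤[1-ε][1+3ε] : ∀ {ε} → 0ℚ ≤ ε → ε < + 1 / 3 → 1ℚ + ε ≤ (1ℚ - ε) * (1ℚ + + 3 / 1 * ε)
  1+ε≤[1-ε][1+3ε] {ε} 0≤ε ε<⅓ = begin
    1ℚ + ε                                    ≡⟨ +-identityʳ (1ℚ + ε) ⟨
    1ℚ + ε + 0ℚ                               ≡⟨ cong (λ z → 1ℚ + ε + z) (*-zeroʳ ε) ⟨
    1ℚ + ε + ε * 0ℚ                           ≤⟨ +-monoʳ-≤ (1ℚ + ε) (*-monoˡ-≤-nonNeg ε {{nonNegative 0≤ε}} 0≤1-3ε) ⟩
    1ℚ + ε + ε * (1ℚ - + 3 / 1 * ε)           ≡⟨ expand ε ⟩
    (1ℚ - ε) * (1ℚ + + 3 / 1 * ε)             ∎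
    where
    open ≤-Reasoning
    open +-*-Solver
    0≤1-3ε : 0ℚ ≤ 1ℚ - + 3 / 1 * ε
    0≤1-3ε = p≤q⇒0≤q-p (<⇒≤ (*-monoʳ-<-pos (+ 3 / 1) ε<⅓))
    expand : ∀ e → 1ℚ + e + e * (1ℚ - + 3 / 1 * e) ≡ (1ℚ - e) * (1ℚ + + 3 / 1 * e)
    expand = solve 1 (λ e → con 1ℚ :+ e :+ e :* (con 1ℚ :- con (+ 3 / 1) :* e)
                          := (con 1ℚ :- e) :* (con 1ℚ :+ con (+ 3 / 1) :* e)) refl

  ratio-bound : ∀ {ε f m} → 0ℚ ≤ ε → ε < + 1 / 3 → 0ℚ ≤ m →
                (1ℚ - ε) * f ≤ (1ℚ + ε) * m → f ≤ (1ℚ + + 3 / 1 * ε) * m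
  ratio-bound {ε} {f} {m} 0≤ε ε<⅓ 0≤m h = *-cancelˡ-≤-pos (1ℚ - ε) {{positive 0<1-ε}} (begin
    (1ℚ - ε) * f                              ≤⟨ h ⟩
    (1ℚ + ε) * m                              ≤⟨ *-monoʳ-≤-nonNeg m {{nonNegative 0≤m}} (1+ε≤[1-ε][1+3ε] 0≤ε ε<⅓) ⟩
    (1ℚ - ε) * (1ℚ + + 3 / 1 * ε) * m         ≡⟨ *-assoc (1ℚ - ε) _ m ⟩
    (1ℚ - ε) * ((1ℚ + + 3 / 1 * ε) * m)       ∎)
    where
    open ≤-Reasoning
    ε<1 : ε < 1ℚ
    ε<1 = <-trans ε<⅓ (*<* (+<+ (ℕ.s≤s (ℕ.s≤s ℕ.z≤n))))
    0<1-ε : 0ℚ < 1ℚ - ε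
    0<1-ε = p<q⇒0<q-p ε<1

  degree-ratio : ∀ {ε c δ Δ} f m → 1ℚ ≤ c → 0ℚ ≤ ε → ε < + 1 / 3 →
                 (1ℚ - ε) * c ≤ ℕ→ℚ δ → ℕ→ℚ Δ ≤ (1ℚ + ε) * c → f ℕ.* δ ℕ.≤ m ℕ.* Δ →
                 ℕ→ℚ f ≤ (1ℚ + + 3 / 1 * ε) * ℕ→ℚ m
  degree-ratio {ε} {c} {δ} {Δ} f m 1≤c 0≤ε ε<⅓ lo hi fδ≤mΔ =
    ratio-bound 0≤ε ε<⅓ (ℕ→ℚ-nonNeg m) (*-cancelʳ-≤-pos c {{positive 0<c}} (begin
      (1ℚ - ε) * ℕ→ℚ f * c          ≡⟨ swap (1ℚ - ε) (ℕ→ℚ f) c ⟩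
      ℕ→ℚ f * ((1ℚ - ε) * c)        ≤⟨ *-monoˡ-≤-nonNeg (ℕ→ℚ f) {{nonNegative (ℕ→ℚ-nonNeg f)}} lo ⟩
      ℕ→ℚ f * ℕ→ℚ δ                ≡⟨ ℕ→ℚ-homo-* f δ ⟨
      ℕ→ℚ (f ℕ.* δ)                ≤⟨ ℕ→ℚ-mono-≤ fδ≤mΔ ⟩
      ℕ→ℚ (m ℕ.* Δ)                ≡⟨ ℕ→ℚ-homo-* m Δ ⟩
      ℕ→ℚ m * ℕ→ℚ Δ                ≤⟨ *-monoˡ-≤-nonNeg (ℕ→ℚ m) {{nonNegative (ℕ→ℚ-nonNeg m)}} hi ⟩
      ℕ→ℚ m * ((1ℚ + ε) * c)        ≡⟨ swap (1ℚ + ε) (ℕ→ℚ m) c ⟨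
      (1ℚ + ε) * ℕ→ℚ m * c          ∎))
    where
    open ≤-Reasoning
    0<c : 0ℚ < c
    0<c = <-≤-trans (*<* (+<+ (ℕ.s≤s ℕ.z≤n))) 1≤c
    swap : ∀ a b d → a * b * d ≡ b * (a * d)
    swap a b d = trans (cong (_* d) (*-comm a b)) (*-assoc b a d)

  0≤[1+3ε]*ℕ→ℚ : ∀ {ε} → 0ℚ ≤ ε → ∀ m → 0ℚ ≤ (1ℚ + + 3 / 1 * ε) * ℕ→ℚ m
  0≤[1+3ε]*ℕ→ℚ {ε} 0≤ε m = begin
    0ℚ                               ≡⟨ *-zeroˡ (ℕ→ℚ m) ⟨
    0ℚ * ℕ→ℚ m                       ≤⟨ *-monoʳ-≤-nonNeg (ℕ→ℚ m) {{nonNegative (ℕ→ℚ-nonNeg m)}} 0≤1+3ε ⟩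
    (1ℚ + + 3 / 1 * ε) * ℕ→ℚ m       ∎
    where
    open ≤-Reasoning
    0≤1+3ε : 0ℚ ≤ 1ℚ + + 3 / 1 * ε
    0≤1+3ε = +-mono-≤ {0ℚ} {1ℚ} {0ℚ} (*≤* (+≤+ ℕ.z≤n)) (*-monoˡ-≤-nonNeg (+ 3 / 1) 0≤ε)

open import Data.Rational using (ℚ; _≤_; _<_; _+_; _*_; 0ℚ; 1ℚ; _/_)
open import Data.Integer using (+_)
import Data.Rational.Properties as ℚ
open import Data.Nat.Properties using (≤-trans; n≤1+n)
open import Data.Product using (_,_; proj₁; proj₂)
open import Data.Sum using (inj₁; inj₂)
open import Function using (_∘_; case_of_)
open import Relation.Binary.PropositionalEquality using (refl; sym; trans; cong)
open Counting using (∧-elim; count-witness; isUnmatched⇒Unmatched; min-attained; max-attained)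
open RationalBounds using (degree-ratio; 0≤[1+3ε]*ℕ→ℚ)

lemma3p14 : (n : ℕ) (G : Graph n) (ε c : ℚ) → 1ℚ ≤ c → 0ℚ ≤ ε → ε < + 1 / 3
    → (K : Fin n → Fin n → Bool) (T : Fin n → Bool) → IsKernel G ε c K T
    → (M : Fin n → Fin n → Bool) → IsMatching K M
    → (∀ (vs : List (Fin n)) → IsAugPath K M vs → 5 Data.Nat.≤ pathLength vs)
    → ℕ→ℚ (count (λ v → T v ∧ isUnmatched M v)) ≤ (1ℚ + + 3 / 1 * ε) * ℕ→ℚ (edgeCount M)
lemma3p14 n G ε c 1≤c 0≤ε ε<⅓ K T ker M mat aug = case count-witness F of λ where
    (inj₁ no-F) → ℚ.≤-trans (ℚ.≤-reflexive (cong ℕ→ℚ no-F)) (0≤[1+3ε]*ℕ→ℚ 0≤ε (edgeCount M))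
    (inj₂ (u₀ , Fu₀)) →
      let z , Fz , z-min = min-attained (deg K) F Fu₀
          w , w-max = max-attained (deg K) u₀
      in degree-ratio (count F) (edgeCount M) 1≤c 0≤ε ε<⅓
                      (IsKernel.degLower ker z (proj₁ (∧-elim {T z} Fz)))
                      (IsKernel.degUpper ker w)
                      (count*δ≤edgeCount*Δ (deg K z) (deg K w) z-min w-max)
  where
  F : Fin n → Bool
  F v = T v ∧ isUnmatched M v
  K⊆G : SymSub K (Graph.adj G)
  K⊆G = IsKernel.sub ker
  K-irrefl : ∀ v → K v v ≡ false
  K-irrefl v with K v v in Kvv
  ... | false = refl
  ... | true with () ← trans (sym (proj₂ K⊆G v v Kvv)) (Graph.irrefl G v)
  F-free : ∀ u → F u ≡ true → Unmatched M u
  F-free u = isUnmatched⇒Unmatched M ∘ proj₂ ∘ ∧-elim {T u}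
  open FreeNeighbours (proj₁ K⊆G) K-irrefl (IsMatching.sub mat) F F-free
                      (λ vs p → ≤-trans (n≤1+n 4) (aug vs p))
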